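{- For every positive integer $r$, $\mathrm{CF}(B_{2(r+1)+3r})\le 4r+2$.
   Context: $B_m$ is the rooted complete binary tree with $m$ levels ($2^m-1$ vertices). For a graph $G$, a conflict-free coloring w.r.t. paths is a function $C\colon V(G)\to\{1,\dots,c\}$ such that for the vertex set of every path of $G$ (including single vertices) some color occurs exactly once on it; $\mathrm{CF}(G)$ is the minimum such $c$. -}

module Defs where

open import Data.Nat using (ℕ; _<_)
open import Data.Bool using (Bool)
open import Data.Fin using (Fin)
import Data.Fin as Fin
open import Data.List using (List; []; _∷_; length; filter)
open import Data.List.Relation.Unary.Linked using (Linked)
open import Data.List.Relation.Unary.Unique.Propositional using (Unique)
open import Data.Product using (Σ; ∃; ∃-syntax; _×_; proj₁)
open import Data.Sum using (_⊎_)
open import Relation.Binary.PropositionalEquality using (_≡_; _≢_)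

-- Vertices of the complete binary tree B m (m levels, 2^m - 1 vertices):
-- a vertex is its address from the root, a list of bits of length < m
-- (the root is [], the children of w are b ∷ w for b : Bool).
Vertex : ℕ → Set
Vertex m = Σ (List Bool) (λ w → length w < m)

ParentOf : ∀ {m} → Vertex m → Vertex m → Set
ParentOf u v = ∃[ b ] (proj₁ v ≡ b ∷ proj₁ u)

Adj : ∀ {m} → Vertex m → Vertex m → Set
Adj u v = ParentOf u v ⊎ ParentOf v u

IsPath : ∀ {m} → List (Vertex m) → Set
IsPath p = (p ≢ []) × Linked Adj p × Unique p

ConflictFree : ∀ {m c} → (Vertex m → Fin c) → Set
ConflictFree {m} {c} C =
  (p : List (Vertex m)) → IsPath p →
  ∃[ k ] (length (filter (λ x → C x Fin.≟ k) p) ≡ 1)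

CF≤ : ℕ → ℕ → Set
CF≤ m c = Σ (Vertex m → Fin c) ConflictFree

module Submission where

-- Split the 5r + 2 levels into r blocks of four levels followed by r + 2 levels coloured by
-- depth. Levels 0, 1, 3 of the top block use colours 0, 1, 2 and level 2 a larger colour; the
-- blocks below are coloured recursively with all colours shifted by 3.
-- A path in a tree climbs to its highest vertex p and descends from it along at most two
-- branches through different children of p. If p lies below the top block, cut that block off.
-- If p lies in the top block, colours 0, 1, 2 do not occur below it, and a finite check shows
-- that the part of the path inside the block has one of them exactly once, unless that part is
-- a lone level-2 vertex, which is then the whole path. If p lies in the depth-coloured part,
-- it is the only vertex of the path at its depth.

open import Defs
open import Data.Nat using (ℕ; zero; suc; _+_; _*_; _∸_; _≤_; _<_; z≤n; s≤s; _≟_; _<?_)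
open import Data.Nat.Properties
  using (+-identityʳ; +-assoc; *-suc; m⊓n≤m; <-≤-trans; <-trans; <-irrefl; m<m+n; +-monoʳ-<;
         +-cancelˡ-<; +-cancelˡ-≡; m+[n∸m]≡n; ≤-irrelevant)
open import Data.Nat.Tactic.RingSolver using (solve-∀)
open import Data.Bool using (Bool; true; false; if_then_else_)
import Data.Bool.Properties as Bool
open import Data.List using (List; []; _∷_; [_]; _++_; _∷ʳ_; length; map; filter; take; reverse)
open import Data.List.Properties
  using (length-++; length-take; ++-assoc; ++-identityʳ; map-++; filter-++; filter-none;
         filter-accept; filter-≐; ∷ʳ-injectiveˡ; unfold-reverse; reverse-injective; length-reverse)
open import Data.List.Membership.Propositional using (_∈_; _∉_)
open import Data.List.Membership.Propositional.Properties using (∈-++⁺ˡ)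
open import Data.List.Relation.Unary.All as All using (All; []; _∷_)
open import Data.List.Relation.Unary.All.Properties using (¬Any⇒All¬; All¬⇒¬Any)
open import Data.List.Relation.Unary.Any using (Any; here; there; any?; satisfied)
open import Data.List.Relation.Unary.AllPairs using (_∷_)
open import Data.List.Relation.Unary.Linked as Linked using (Linked; _∷_)
import Data.List.Relation.Unary.Linked.Properties as Linked
open import Data.List.Relation.Unary.Unique.Propositional using (Unique)
import Data.List.Relation.Unary.Unique.Propositional.Properties as Unique
open import Data.List.Relation.Binary.Permutation.Propositional
  using (_↭_; ↭-refl; ↭-sym; ↭-trans; prep; swap; module PermutationReasoning)
open import Data.List.Relation.Binary.Permutation.Propositional.Properties
  using (filter-↭; ↭-length; ∈-resp-↭; shift)
open import Data.Fin using (Fin; toℕ; fromℕ<)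
import Data.Fin as Fin
open import Data.Fin.Properties using (toℕ<n; fromℕ<-cong; fromℕ<-injective)
import Data.Fin.Properties as Fin
open import Data.Product using (∃-syntax; _×_; _,_; proj₁)
import Data.Product as Product
open import Data.Sum using (_⊎_; inj₁; inj₂)
import Data.Sum as Sum
open import Data.Empty using (⊥-elim)
open import Data.Unit using (⊤; tt)
open import Function using (_∘_)
open import Relation.Nullary using (Dec; does; ¬?; yes; no; contradiction)
open import Relation.Nullary.Decidable using (map′; _×-dec_; _→-dec_; from-yes)
open import Relation.Binary.PropositionalEquality
  using (_≡_; _≢_; refl; sym; trans; cong; cong₂; subst; subst₂; module ≡-Reasoning)

module _ {A : Set} (f : A → ℕ) (n : ℕ) where

  count : List A → ℕ
  count = length ∘ filter (λ x → f x ≟ n)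

  count-++ : ∀ xs ys → count (xs ++ ys) ≡ count xs + count ys
  count-++ xs ys = trans (cong length (filter-++ _ xs ys)) (length-++ (filter _ xs))

  count-∷ : ∀ x {xs ys} → count xs ≡ count ys → count (x ∷ xs) ≡ count (x ∷ ys)
  count-∷ x eq with does (f x ≟ n)
  ... | true  = cong suc eq
  ... | false = eq

  count-↭ : ∀ {xs ys} → xs ↭ ys → count xs ≡ count ys
  count-↭ = ↭-length ∘ filter-↭ _

  count-none : ∀ {xs} → All (λ x → f x ≢ n) xs → count xs ≡ 0
  count-none = cong length ∘ filter-none _

  count≡1⇒any : ∀ xs → count xs ≡ 1 → Any (λ x → f x ≡ n) xs
  count≡1⇒any xs eq with any? (λ x → f x ≟ n) xs
  ... | yes found = found
  ... | no  none  = contradiction (trans (sym (count-none (¬Any⇒All¬ xs none))) eq) λ ()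

count-singleton : ∀ {A : Set} (f : A → ℕ) x → count f (f x) [ x ] ≡ 1
count-singleton f x = cong length (filter-accept (λ y → f y ≟ f x) refl)

count-map : ∀ {A B : Set} (f : B → ℕ) (g : A → B) n xs → count f n (map g xs) ≡ count (f ∘ g) n xs
count-map f g n []       = refl
count-map f g n (x ∷ xs) with does (f (g x) ≟ n)
... | true  = cong suc (count-map f g n xs)
... | false = count-map f g n xs

HasUniqueColour : ∀ {A : Set} → (A → ℕ) → List A → Set
HasUniqueColour f xs = ∃[ n ] count f n xs ≡ 1

-- Addresses are read from the root (Defs reads them from the vertex), so that a block of
-- levels is a prefix.
Word : Set
Word = List Bool

descent : Word → List Bool → List Word
descent p []       = []
descent p (b ∷ bs) = (p ∷ʳ b) ∷ descent (p ∷ʳ b) bs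

valley : Word → List Bool → List Bool → List Word
valley p ls rs = p ∷ descent p ls ++ descent p rs

Apart : List Bool → List Bool → Set
Apart []      _       = ⊤
Apart (_ ∷ _) []      = ⊤
Apart (l ∷ _) (r ∷ _) = l ≢ r

length-∷ʳ : ∀ (p : Word) b → length (p ∷ʳ b) ≡ length p + 1
length-∷ʳ p b = length-++ p

descent-++ : ∀ p xs ys → descent p (xs ++ ys) ≡ descent p xs ++ descent (p ++ xs) ys
descent-++ p []       ys = cong (λ q → descent q ys) (sym (++-identityʳ p))
descent-++ p (x ∷ xs) ys = cong ((p ∷ʳ x) ∷_) (begin
  descent (p ∷ʳ x) (xs ++ ys)                        ≡⟨ descent-++ (p ∷ʳ x) xs ys ⟩
  descent (p ∷ʳ x) xs ++ descent ((p ∷ʳ x) ++ xs) ys ≡⟨ cong (λ q → D ++ descent q ys) (++-assoc p [ x ] xs) ⟩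
  descent (p ∷ʳ x) xs ++ descent (p ++ x ∷ xs) ys    ∎)
  where
  open ≡-Reasoning
  D : List Word
  D = descent (p ∷ʳ x) xs

descent-prefix : ∀ q p bs → descent (q ++ p) bs ≡ map (q ++_) (descent p bs)
descent-prefix q p []       = refl
descent-prefix q p (b ∷ bs) rewrite ++-assoc q p [ b ] = cong (_ ∷_) (descent-prefix q (p ∷ʳ b) bs)

valley-prefix : ∀ q p ls rs → valley (q ++ p) ls rs ≡ map (q ++_) (valley p ls rs)
valley-prefix q p ls rs = cong ((q ++ p) ∷_)
  (trans (cong₂ _++_ (descent-prefix q p ls) (descent-prefix q p rs))
         (sym (map-++ (q ++_) (descent p ls) (descent p rs))))

descent-longer : ∀ p bs → All (λ q → length p < length q) (descent p bs)
descent-longer p []       = []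
descent-longer p (b ∷ bs) = p<p∷ʳb ∷ All.map (<-trans p<p∷ʳb) (descent-longer (p ∷ʳ b) bs)
  where
  p<p∷ʳb : length p < length (p ∷ʳ b)
  p<p∷ʳb = subst (length p <_) (sym (length-∷ʳ p b)) (m<m+n (length p) (s≤s z≤n))

count-valley : ∀ f n p ls rs →
  count f n (valley p ls rs) ≡ count f n [ p ] + (count f n (descent p ls) + count f n (descent p rs))
count-valley f n p ls rs = trans (count-++ f n [ p ] _) (cong (_ +_) (count-++ f n (descent p ls) _))

count-descent-none : ∀ f n p bs → (∀ q → length p < length q → f q ≢ n) →
  count f n (descent p bs) ≡ 0
count-descent-none f n p bs fresh = count-none f n (All.map (λ {q} → fresh q) (descent-longer p bs))

count-top≡1 : ∀ f p ls rs → (∀ q → length p < length q → f q ≢ f p) →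
  count f (f p) (valley p ls rs) ≡ 1
count-top≡1 f p ls rs fresh = trans (count-valley f (f p) p ls rs)
  (cong₂ _+_ (count-singleton f p)
             (cong₂ _+_ (count-descent-none f (f p) p ls fresh) (count-descent-none f (f p) p rs fresh)))

Child : Word → Word → Set
Child u v = ∃[ b ] v ≡ u ∷ʳ b

Edge : Word → Word → Set
Edge u v = Child u v ⊎ Child v u

record ValleyFrom (x : Word) (xs : List Word) : Set where
  field
    top         : Word
    left right  : List Bool
    apart       : Apart left right
    starts      : x ≡ top ++ left
    permutation : x ∷ xs ↭ valley top left right

parent-on-descent : ∀ p l ls {x b} → p ++ l ∷ ls ≡ x ∷ʳ b → x ∈ p ∷ descent p (l ∷ ls)
parent-on-descent p l []        {x} eq = here (sym (∷ʳ-injectiveˡ p x eq))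
parent-on-descent p l (l′ ∷ ls)     eq =
  there (parent-on-descent (p ∷ʳ l) l′ ls (trans (++-assoc p [ l ] (l′ ∷ ls)) eq))

Apart-∷ʳ : ∀ p ls rs b → Apart ls rs → (p ++ ls) ∷ʳ b ∉ valley p ls rs → Apart (ls ∷ʳ b) rs
Apart-∷ʳ p []      []      b _  _   = tt
Apart-∷ʳ p []      (c ∷ _) b _  new = λ b≡c → new (there (here (cong₂ _∷ʳ_ (++-identityʳ p) b≡c)))
Apart-∷ʳ p (_ ∷ _) []      b _  _   = tt
Apart-∷ʳ p (_ ∷ _) (_ ∷ _) b ap _   = ap

valley-∷ʳ : ∀ p ls rs b → ((p ++ ls) ∷ʳ b) ∷ valley p ls rs ↭ valley p (ls ∷ʳ b) rs
valley-∷ʳ p ls rs b = begin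
  x ∷ p ∷ D ++ R      ↭⟨ swap x p ↭-refl ⟩
  p ∷ x ∷ D ++ R      ↭⟨ prep p (↭-sym (shift x D R)) ⟩
  p ∷ D ++ x ∷ R      ≡⟨ cong (p ∷_) (sym (++-assoc D [ x ] R)) ⟩
  p ∷ (D ∷ʳ x) ++ R   ≡⟨ cong (λ E → p ∷ E ++ R) (sym (descent-++ p ls [ b ])) ⟩
  valley p (ls ∷ʳ b) rs ∎
  where
  open PermutationReasoning
  x : Word
  x = (p ++ ls) ∷ʳ b
  D R : List Word
  D = descent p ls
  R = descent p rs

extend : ∀ {x y xs} → Edge x y → All (x ≢_) (y ∷ xs) → ValleyFrom y xs → ValleyFrom x (y ∷ xs)
extend {x} (inj₂ (b , refl)) x∉
  record { top = p ; left = ls ; right = rs ; apart = ap ; starts = refl ; permutation = perm } =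
  record { top = p ; left = ls ∷ʳ b ; right = rs
         ; apart = Apart-∷ʳ p ls rs b ap (All¬⇒¬Any x∉ ∘ ∈-resp-↭ (↭-sym perm))
         ; starts = ++-assoc p ls [ b ]
         ; permutation = ↭-trans (prep x perm) (valley-∷ʳ p ls rs b) }
extend {x} (inj₁ (b , refl)) _
  record { top = p ; left = [] ; right = rs ; starts = y≡p++[] ; permutation = perm } =
  record { top = x ; left = [] ; right = b ∷ rs ; apart = tt ; starts = sym (++-identityʳ x)
         ; permutation = prep x (subst (λ t → _ ↭ valley t [] rs) p≡x∷ʳb perm) }
  where
  p≡x∷ʳb : p ≡ x ∷ʳ b
  p≡x∷ʳb = trans (sym (++-identityʳ p)) (sym y≡p++[])
extend {x} (inj₁ (b , refl)) x∉
  record { top = p ; left = l ∷ ls ; right = rs ; starts = y≡p++l∷ls ; permutation = perm } =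
  ⊥-elim (All¬⇒¬Any x∉ (∈-resp-↭ (↭-sym perm) x∈valley))
  where
  x∈valley : x ∈ valley p (l ∷ ls) rs
  x∈valley = ∈-++⁺ˡ (parent-on-descent p l ls (sym y≡p++l∷ls))

path⇒valley : ∀ x xs → Linked Edge (x ∷ xs) → Unique (x ∷ xs) → ValleyFrom x xs
path⇒valley x []       _             _             = record
  { top = x ; left = [] ; right = [] ; apart = tt ; starts = sym (++-identityʳ x) ; permutation = ↭-refl }
path⇒valley x (y ∷ xs) (e ∷ linked) (x∉ ∷ unique) = extend e x∉ (path⇒valley y xs linked unique)

-- The level-2 colour 3r + 3 of a block is also the colour of the first level of the
-- depth-coloured part, so it costs no extra colour.
colour : ℕ → Word → ℕ
colour zero    bs                   = length bs
colour (suc r) (_ ∷ _ ∷ _ ∷ _ ∷ bs) = 3 + colour r bs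
colour (suc r) []                   = 0
colour (suc r) (b ∷ [])             = if b then 2 else 1
colour (suc r) (_ ∷ _ ∷ [])         = 3 + 3 * r
colour (suc r) (b₁ ∷ _ ∷ b₃ ∷ [])   = if b₃ then (if b₁ then 1 else 2) else 0

colour-< : ∀ r {k} → 0 < k → ∀ bs → length bs < 4 * r + k → colour r bs < 3 * r + k
colour-< zero        _   bs lt = lt
colour-< (suc r) {k} 0<k bs lt = subst (colour (suc r) bs <_) (sym (blocks 3)) (below bs lt)
  where
  blocks : ∀ m → m * suc r + k ≡ m + (m * r + k)
  blocks m = trans (cong (_+ k) (*-suc m r)) (+-assoc m (m * r) k)

  below : ∀ bs → length bs < 4 * suc r + k → colour (suc r) bs < 3 + (3 * r + k)
  below (_ ∷ _ ∷ _ ∷ _ ∷ bs) lt =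
    +-monoʳ-< 3 (colour-< r 0<k bs (+-cancelˡ-< 4 _ _ (subst (4 + length bs <_) (blocks 4) lt)))
  below []                      _ = s≤s z≤n
  below (false ∷ [])            _ = s≤s (s≤s z≤n)
  below (true ∷ [])             _ = s≤s (s≤s (s≤s z≤n))
  below (_ ∷ _ ∷ [])            _ = +-monoʳ-< 3 (m<m+n (3 * r) 0<k)
  below (_ ∷ _ ∷ false ∷ [])    _ = s≤s z≤n
  below (true ∷ _ ∷ true ∷ [])  _ = s≤s (s≤s z≤n)
  below (false ∷ _ ∷ true ∷ []) _ = s≤s (s≤s (s≤s z≤n))

colour-deep : ∀ r q → 4 ≤ length q → 3 ≤ colour (suc r) q
colour-deep r (_ ∷ _ ∷ _ ∷ _ ∷ q) _ = s≤s (s≤s (s≤s z≤n))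
colour-deep r []                  ()
colour-deep r (_ ∷ [])            (s≤s ())
colour-deep r (_ ∷ _ ∷ [])        (s≤s (s≤s ()))
colour-deep r (_ ∷ _ ∷ _ ∷ [])    (s≤s (s≤s (s≤s ())))

count-block-shift : ∀ r b₁ b₂ b₃ b₄ n xs →
  count (colour (suc r)) (3 + n) (map ((b₁ ∷ b₂ ∷ b₃ ∷ b₄ ∷ []) ++_) xs) ≡ count (colour r) n xs
count-block-shift r b₁ b₂ b₃ b₄ n xs = trans (count-map (colour (suc r)) _ (3 + n) xs)
  (cong length (filter-≐ (λ w → 3 + colour r w ≟ 3 + n) (λ w → colour r w ≟ n)
                         (+-cancelˡ-≡ 3 _ _ , cong (3 +_)) xs))

count-descent-take : ∀ r {n} → n < 3 → ∀ k p bs → length p + k ≡ 3 →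
  count (colour (suc r)) n (descent p bs) ≡ count (colour (suc r)) n (descent p (take k bs))
count-descent-take r {n} n<3 zero p bs p+0≡3 = count-descent-none (colour (suc r)) n p bs deep
  where
  deep : ∀ q → length p < length q → colour (suc r) q ≢ n
  deep q p<q c≡n = <-irrefl (sym c≡n)
    (<-≤-trans n<3 (colour-deep r q (subst (_< length q) (trans (sym (+-identityʳ _)) p+0≡3) p<q)))
count-descent-take r n<3 (suc k) p []       _  = refl
count-descent-take r n<3 (suc k) p (b ∷ bs) eq = count-∷ (colour (suc r)) _ (p ∷ʳ b)
  (count-descent-take r n<3 k (p ∷ʳ b) bs p∷ʳb+k≡3)
  where
  p∷ʳb+k≡3 : length (p ∷ʳ b) + k ≡ 3
  p∷ʳb+k≡3 = trans (cong (_+ k) (length-∷ʳ p b)) (trans (+-assoc (length p) 1 k) eq)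

count-valley-take : ∀ r {n} → n < 3 → ∀ k p ls rs → length p + k ≡ 3 →
  count (colour (suc r)) n (valley p ls rs) ≡ count (colour (suc r)) n (valley p (take k ls) (take k rs))
count-valley-take r {n} n<3 k p ls rs eq = begin
  count c n (valley p ls rs)                              ≡⟨ count-valley c n p ls rs ⟩
  count c n [ p ] + (count c n (descent p ls) + count c n (descent p rs))
    ≡⟨ cong (count c n [ p ] +_) (cong₂ _+_ (truncate ls) (truncate rs)) ⟩
  count c n [ p ] + (count c n (descent p (take k ls)) + count c n (descent p (take k rs)))
    ≡⟨ count-valley c n p (take k ls) (take k rs) ⟨
  count c n (valley p (take k ls) (take k rs))            ∎
  where
  open ≡-Reasoning
  c : Word → ℕ
  c = colour (suc r)
  truncate : ∀ bs → count c n (descent p bs) ≡ count c n (descent p (take k bs))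
  truncate bs = count-descent-take r n<3 k p bs eq

apart? : ∀ ls rs → Dec (Apart ls rs)
apart? []      _       = yes tt
apart? (_ ∷ _) []      = yes tt
apart? (l ∷ _) (r ∷ _) = ¬? (l Bool.≟ r)

Apart-take : ∀ k ls rs → Apart ls rs → Apart (take k ls) (take k rs)
Apart-take zero    _       _       _  = tt
Apart-take (suc k) []      _       _  = tt
Apart-take (suc k) (_ ∷ _) []      _  = tt
Apart-take (suc k) (_ ∷ _) (_ ∷ _) ap = ap

∀-length≤? : ∀ {P : List Bool → Set} → (∀ bs → Dec (P bs)) → ∀ k →
  Dec (∀ bs → length bs ≤ k → P bs)
∀-length≤?     P? zero    = map′ (λ { P[] [] _ → P[] }) (λ ∀P → ∀P [] z≤n) (P? [])
∀-length≤? {P} P? (suc k) =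
  map′ join split (P? [] ×-dec ∀-length≤? (P? ∘ (false ∷_)) k ×-dec ∀-length≤? (P? ∘ (true ∷_)) k)
  where
  Below : (List Bool → List Bool) → Set
  Below prefix = ∀ bs → length bs ≤ k → P (prefix bs)

  join : P [] × Below (false ∷_) × Below (true ∷_) → ∀ bs → length bs ≤ suc k → P bs
  join (P[] , _  , _ ) []           _        = P[]
  join (_   , Pf , _ ) (false ∷ bs) (s≤s le) = Pf bs le
  join (_   , _  , Pt) (true ∷ bs)  (s≤s le) = Pt bs le

  split : (∀ bs → length bs ≤ suc k → P bs) → P [] × Below (false ∷_) × Below (true ∷_)
  split ∀P = ∀P [] z≤n , (λ bs le → ∀P (false ∷ bs) (s≤s le)) ,
             (λ bs le → ∀P (true ∷ bs) (s≤s le))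

LowColourUnique : ℕ → Word → List Bool → List Bool → Set
LowColourUnique r p ls rs = Apart ls rs → (length p ≡ 2 → 0 < length ls + length rs) →
  ∃[ n ] count (colour (suc r)) (toℕ {3} n) (valley p ls rs) ≡ 1

lowColourUnique? : ∀ r p ls rs → Dec (LowColourUnique r p ls rs)
lowColourUnique? r p ls rs = apart? ls rs →-dec (length p ≟ 2 →-dec 0 <? length ls + length rs) →-dec
  Fin.any? (λ n → count (colour (suc r)) (toℕ n) (valley p ls rs) ≟ 1)

-- Decided by evaluation; r only enters through the level-2 colour 3 + 3 * r, which is never below 3.
topBlock-lowColourUnique : ∀ r p → length p ≤ 3 →
  ∀ ls → length ls ≤ 3 ∸ length p → ∀ rs → length rs ≤ 3 ∸ length p → LowColourUnique r p ls rs
topBlock-lowColourUnique r = from-yes (∀-length≤? (λ p →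
  ∀-length≤? (λ ls → ∀-length≤? (lowColourUnique? r p ls) (3 ∸ length p)) (3 ∸ length p)) 3)

topBlock-truncated : ∀ r p ls rs → length p ≤ 3 → Apart ls rs →
  (length p ≡ 2 → 0 < length (take (3 ∸ length p) ls) + length (take (3 ∸ length p) rs)) →
  HasUniqueColour (colour (suc r)) (valley p ls rs)
topBlock-truncated r p ls rs p≤3 ap nonsingleton =
  let n , eq = topBlock-lowColourUnique r p p≤3 (take k ls) (short ls) (take k rs) (short rs)
                 (Apart-take k ls rs ap) nonsingleton
  in  toℕ n , trans (count-valley-take r (toℕ<n n) k p ls rs (m+[n∸m]≡n p≤3)) eq
  where
  k : ℕ
  k = 3 ∸ length p
  short : ∀ bs → length (take k bs) ≤ k
  short bs = subst (_≤ k) (sym (length-take k bs)) (m⊓n≤m k _)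

topBlock-uniqueColour : ∀ r p → length p ≤ 3 → ∀ ls rs → Apart ls rs →
  HasUniqueColour (colour (suc r)) (valley p ls rs)
topBlock-uniqueColour r p _   []       []       _  = colour (suc r) p , count-singleton (colour (suc r)) p
topBlock-uniqueColour r p p≤3 (l ∷ ls) rs       ap = topBlock-truncated r p (l ∷ ls) rs p≤3 ap λ p≡2 →
  subst (λ k → 0 < length (take k (l ∷ ls)) + length (take k rs)) (cong (3 ∸_) (sym p≡2)) (s≤s z≤n)
topBlock-uniqueColour r p p≤3 []       (c ∷ rs) ap = topBlock-truncated r p [] (c ∷ rs) p≤3 ap λ p≡2 →
  subst (λ k → 0 < length (take {A = Bool} k []) + length (take k (c ∷ rs))) (cong (3 ∸_) (sym p≡2))
        (s≤s z≤n)

valley-uniqueColour : ∀ r p ls rs → Apart ls rs → HasUniqueColour (colour r) (valley p ls rs)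
valley-uniqueColour zero p ls rs _ =
  length p , count-top≡1 length p ls rs λ q p<q q≡p → <-irrefl (sym q≡p) p<q
valley-uniqueColour (suc r) (b₁ ∷ b₂ ∷ b₃ ∷ b₄ ∷ p) ls rs ap =
  let n , eq = valley-uniqueColour r p ls rs ap
      block  = b₁ ∷ b₂ ∷ b₃ ∷ b₄ ∷ []
  in  3 + n , trans (cong (count (colour (suc r)) (3 + n)) (valley-prefix block p ls rs))
                    (trans (count-block-shift r b₁ b₂ b₃ b₄ n (valley p ls rs)) eq)
valley-uniqueColour (suc r) p@[]               = topBlock-uniqueColour r p z≤n
valley-uniqueColour (suc r) p@(_ ∷ [])         = topBlock-uniqueColour r p (s≤s z≤n)
valley-uniqueColour (suc r) p@(_ ∷ _ ∷ [])     = topBlock-uniqueColour r p (s≤s (s≤s z≤n))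
valley-uniqueColour (suc r) p@(_ ∷ _ ∷ _ ∷ []) = topBlock-uniqueColour r p (s≤s (s≤s (s≤s z≤n)))

path-uniqueColour : ∀ r x xs → Linked Edge (x ∷ xs) → Unique (x ∷ xs) →
  HasUniqueColour (colour r) (x ∷ xs)
path-uniqueColour r x xs linked unique =
  let open ValleyFrom (path⇒valley x xs linked unique)
      n , eq = valley-uniqueColour r top left right apart
  in  n , trans (count-↭ (colour r) n permutation) eq

word : ∀ {m} → Vertex m → Word
word = reverse ∘ proj₁

word-injective : ∀ {m} {u v : Vertex m} → word u ≡ word v → u ≡ v
word-injective {u = w , w<} {v = w′ , w<′} eq with refl ← reverse-injective {x = w} {y = w′} eq =
  cong (w ,_) (≤-irrelevant w< w<′)

parent⇒child : ∀ {m} (u v : Vertex m) → ParentOf u v → Child (word u) (word v)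
parent⇒child u v (b , eq) = b , trans (cong reverse eq) (unfold-reverse b (proj₁ u))

adj⇒edge : ∀ {m} (u v : Vertex m) → Adj u v → Edge (word u) (word v)
adj⇒edge u v = Sum.map (parent⇒child u v) (parent⇒child v u)

vertexPath-uniqueColour : ∀ r {m} (p : List (Vertex m)) → IsPath p → HasUniqueColour (colour r ∘ word) p
vertexPath-uniqueColour r []       (nonempty , _) = ⊥-elim (nonempty refl)
vertexPath-uniqueColour r (x ∷ xs) (_ , linked , unique) =
  Product.map₂ (trans (sym (count-map (colour r) word _ (x ∷ xs))))
    (path-uniqueColour r (word x) (map word xs)
      (Linked.map⁺ (Linked.map (λ {u v} → adj⇒edge u v) linked))
      (Unique.map⁺ (λ {u v} → word-injective {u = u} {v}) unique))

uniqueColour-fromℕ< : ∀ {A : Set} {c} (f : A → ℕ) (f< : ∀ x → f x < c) xs →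
  HasUniqueColour f xs → ∃[ k ] length (filter (λ x → fromℕ< (f< x) Fin.≟ k) xs) ≡ 1
uniqueColour-fromℕ< f f< xs (n , eq) = fromℕ< n<c , trans (cong length (filter-≐ _ _ (to , from) xs)) eq
  where
  n<c : n < _
  n<c = let x , fx≡n = satisfied (count≡1⇒any f n xs eq) in subst (_< _) fx≡n (f< x)
  to : ∀ {x} → fromℕ< (f< x) ≡ fromℕ< n<c → f x ≡ n
  to {x} = fromℕ<-injective _ _ (f< x) n<c
  from : ∀ {x} → f x ≡ n → fromℕ< (f< x) ≡ fromℕ< n<c
  from {x} fx≡n = fromℕ<-cong _ _ fx≡n (f< x) n<c

corollary1 : (r : ℕ) → 1 ≤ r → CF≤ (2 * (r + 1) + 3 * r) (4 * r + 2)
corollary1 r _ = C , λ p path →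
  uniqueColour-fromℕ< (colour r ∘ word) colour< p (vertexPath-uniqueColour r p path)
  where
  levels : ∀ r → 2 * (r + 1) + 3 * r ≡ 4 * r + (2 + r)
  levels = solve-∀

  colours : ∀ r → 3 * r + (2 + r) ≡ 4 * r + 2
  colours = solve-∀

  colour< : (v : Vertex (2 * (r + 1) + 3 * r)) → colour r (word v) < 4 * r + 2
  colour< (w , w<) = subst (colour r (reverse w) <_) (colours r)
    (colour-< r (s≤s z≤n) (reverse w) (subst₂ _<_ (sym (length-reverse w)) (levels r) w<))

  C : Vertex (2 * (r + 1) + 3 * r) → Fin (4 * r + 2)
  C v = fromℕ< (colour< v)
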